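{- Let $f:\mathbb{F}_2^n\to\mathbb{F}_2^n$ be a conjunctive Boolean network whose dependency graph $\mathfrak{D}(f)$ is strongly connected with loop number $c$. If $p$ is a prime and $p^k$ divides $c$ for some $k\ge1$, then the number of periodic points of $f$ of period exactly $p^k$ is $2^{p^k}-2^{p^{k-1}}$.
   Context: $\mathbb{F}_2=\{0,1\}$. A conjunctive Boolean network is a map $f=(f_1,\dots,f_n):\mathbb{F}_2^n\to\mathbb{F}_2^n$ where each $f_i$ is a product (AND) of a nonempty set of variables. Its dependency graph $\mathfrak{D}(f)$ has vertices $1,\dots,n$ and an edge $i\to j$ iff $x_i$ appears in $f_j$. The loop number of a strongly connected graph (with at least one edge) is the gcd of the lengths of its simple directed cycles. A point $\mathbf{u}$ has period $t$ if $t$ is the least positive integer with $f^t(\mathbf{u})=\mathbf{u}$. -}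

module Defs where

open import Data.Nat using (ℕ; zero; suc; _<_; _≤_)
open import Data.Nat.Divisibility using (_∣_)
open import Data.Bool using (Bool; true; false; _∧_; _∨_; not)
open import Data.Fin using (Fin)
open import Data.Vec using (Vec; lookup; tabulate)
import Data.Vec.Functional as VF
open import Data.List using (List; length)
open import Data.List.Relation.Unary.Unique.Propositional using (Unique)
open import Data.List.Membership.Propositional using (_∈_)
open import Data.Product using (Σ; ∃; _×_)
open import Function.Bundles using (_⇔_)
open import Relation.Binary.PropositionalEquality using (_≡_; _≢_)
open import Relation.Binary.Construct.Closure.ReflexiveTransitive using (Star)

-- A conjunctive Boolean network on n variables over F₂ = Bool is given by
-- its input sets:  inputs j i ≡ true  iff  x_i appears in f_j.
CBN : ℕ → Set
CBN n = Fin n → Fin n → Bool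

NonemptyInputs : ∀ {n} → CBN n → Set
NonemptyInputs {n} inp = ∀ (j : Fin n) → ∃ λ (i : Fin n) → inp j i ≡ true

⋀ : ∀ {n} → (Fin n → Bool) → Bool
⋀ g = VF.foldr _∧_ true g

apply : ∀ {n} → CBN n → Vec Bool n → Vec Bool n
apply inp x = tabulate λ j → ⋀ (λ i → not (inp j i) ∨ lookup x i)

iter : ∀ {A : Set} → (A → A) → ℕ → A → A
iter g zero x = x
iter g (suc t) x = g (iter g t x)

Edge : ∀ {n} → CBN n → Fin n → Fin n → Set
Edge inp i j = inp j i ≡ true

StronglyConnected : ∀ {n} → CBN n → Set
StronglyConnected {n} inp = ∀ (i j : Fin n) → Star (Edge inp) i j

SimpleCycle : ∀ {n} → CBN n → ℕ → Set
SimpleCycle {n} inp L =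
  1 ≤ L × Σ (ℕ → Fin n) λ w →
    (∀ i → i < L → Edge inp (w i) (w (suc i))) ×
    w L ≡ w 0 ×
    (∀ i j → i < L → j < L → w i ≡ w j → i ≡ j)

IsLoopNumber : ∀ {n} → CBN n → ℕ → Set
IsLoopNumber inp c =
  (∀ L → SimpleCycle inp L → c ∣ L) ×
  (∀ d → (∀ L → SimpleCycle inp L → d ∣ L) → d ∣ c)

HasPeriod : ∀ {A : Set} → (A → A) → ℕ → A → Set
HasPeriod g t u = 1 ≤ t × iter g t u ≡ u × (∀ s → 1 ≤ s → s < t → iter g s u ≢ u)

HasCardinality : ∀ {A : Set} → (A → Set) → ℕ → Set
HasCardinality {A} P N =
  Σ (List A) λ xs → Unique xs × (∀ x → (x ∈ xs) ⇔ P x) × length xs ≡ N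

-- Every closed walk of the dependency graph splits into simple cycles, so its length is a
-- multiple of the loop number c, hence of every t dividing c.  For such t, fix a root r and let
-- level v be the length of a walk from r to v: levels are well defined modulo t and grow by one
-- along each edge.  If f^t x = x then (f^(s+1) x)_v = (f^s x)_u along every edge u → v: truth
-- flows backwards along edges because f_v is a conjunction, and forwards because going around a
-- closed walk (length divisible by t) returns to the same state.  So x is determined by the
-- trajectory of r over one period, and every y ∈ F₂^t arises, via v ↦ y (s - level v) at time s.
-- Thus f^t has exactly 2^t fixed points.  A proper divisor of p^k divides p^(k-1), so the points
-- of period exactly p^k are the fixed points of f^(p^k) that are not fixed by f^(p^(k-1)).

module Submission where

open import Defs
open import Data.Bool using (Bool; true; false; not; _∨_)
open import Data.Bool.Properties using () renaming (_≟_ to _≟ᵇ_)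
open import Data.Empty using (⊥-elim)
open import Data.Fin using (Fin; toℕ) renaming (zero to fzero; suc to fsuc)
open import Data.Fin.Properties using (fromℕ<-cong; fromℕ<-toℕ; toℕ-fromℕ<; toℕ<n) renaming (_≟_ to _≟ᶠ_)
open import Data.List using (List; []; _∷_; map; _++_; length; filter)
open import Data.List.Properties using (length-++; length-map)
open import Data.List.Membership.Propositional using (_∈_)
open import Data.List.Membership.Propositional.Properties
  using (∈-map⁺; ∈-map⁻; ∈-++⁺ˡ; ∈-++⁺ʳ; ∈-filter⁺; ∈-filter⁻)
open import Data.List.Membership.Propositional.Properties.WithK using (unique∧set⇒bag)
open import Data.List.Relation.Binary.BagAndSetEquality using (∼bag⇒↭)
open import Data.List.Relation.Binary.Permutation.Propositional.Properties using (↭-length)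
open import Data.List.Relation.Unary.Any using (here)
import Data.List.Relation.Unary.All as All
open import Data.List.Relation.Unary.Unique.Propositional using (Unique; []; _∷_)
import Data.List.Relation.Unary.Unique.Propositional.Properties as Unique
open import Data.Nat
open import Data.Nat.Properties
open import Data.Nat.Divisibility
open import Data.Nat.DivMod
open import Data.Nat.GCD using (gcd; gcd[m,n]∣m; gcd[m,n]∣n; gcd-GCD; module Bézout)
open import Data.Nat.Coprimality using (Coprime; coprime-divisor)
open import Data.Nat.Induction using (<-rec)
open import Data.Nat.Primality using (Prime; prime⇒irreducible; prime⇒nonZero; prime⇒nonTrivial)
open import Data.Nat.Tactic.RingSolver using (solve-∀)
open import Data.Product using (∃; _×_; _,_; proj₁; proj₂)
open import Data.Sum using (_⊎_; inj₁; inj₂)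
open import Data.Vec using (Vec; []; _∷_; lookup; tabulate)
open import Data.Vec.Properties using (∷-injectiveʳ; lookup∘tabulate; tabulate-cong; tabulate∘lookup; ≡-dec)
open import Function using (_∘_)
open import Function.Bundles using (_⇔_; mk⇔; Equivalence)
open import Function.Properties.Equivalence using () renaming (trans to ⇔-trans; sym to ⇔-sym)
open import Data.Unit using (⊤; tt)
open import Relation.Binary.Construct.Closure.ReflexiveTransitive using (Star; ε; _◅_; _◅◅_)
open import Relation.Binary.PropositionalEquality
open import Relation.Binary.Definitions using (tri<; tri≈; tri>)
open import Relation.Nullary using (¬_; Dec; yes; no; ¬?)
open import Relation.Unary using (Decidable)

open ≡-Reasoning

-- Periodic points of maps

Periodic : {A : Set} → (A → A) → ℕ → A → Set
Periodic g m x = iter g m x ≡ x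

module _ {A : Set} (g : A → A) where

  iter-+ : ∀ m n x → iter g (m + n) x ≡ iter g m (iter g n x)
  iter-+ zero    n x = refl
  iter-+ (suc m) n x = cong g (iter-+ m n x)

  periodic-+ : ∀ m n {x} → Periodic g m x → Periodic g n x → Periodic g (m + n) x
  periodic-+ m n {x} pm pn = trans (iter-+ m n x) (trans (cong (iter g m) pn) pm)

  periodic-+-cancelʳ : ∀ m n {x} → Periodic g (m + n) x → Periodic g n x → Periodic g m x
  periodic-+-cancelʳ m n {x} pmn pn = trans (cong (iter g m) (sym pn)) (trans (sym (iter-+ m n x)) pmn)

  periodic-* : ∀ m {x} → Periodic g m x → ∀ q → Periodic g (q * m) x
  periodic-* m pm zero    = refl
  periodic-* m pm (suc q) = periodic-+ m (q * m) pm (periodic-* m pm q)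

  periodic-∣ : ∀ {m n x} → m ∣ n → Periodic g m x → Periodic g n x
  periodic-∣ {m} (divides q refl) pm = periodic-* m pm q

  periodic-gcd : ∀ m n {x} → Periodic g m x → Periodic g n x → Periodic g (gcd m n) x
  periodic-gcd m n {x} pm pn with Bézout.identity (gcd-GCD m n)
  ... | Bézout.+- a b eq = periodic-+-cancelʳ (gcd m n) (b * n)
          (subst (λ s → Periodic g s x) (sym eq) (periodic-* m pm a)) (periodic-* n pn b)
  ... | Bézout.-+ a b eq = periodic-+-cancelʳ (gcd m n) (a * m)
          (subst (λ s → Periodic g s x) (sym eq) (periodic-* n pn b)) (periodic-* m pm a)

∣p^[1+k]⇒∣p^k⊎≡p^[1+k] : ∀ {p} → Prime p → ∀ k {d} → d ∣ p ^ suc k → d ∣ p ^ k ⊎ d ≡ p ^ suc k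
∣p^[1+k]⇒∣p^k⊎≡p^[1+k] {p} p-prime k {d} d∣p^[1+k] with p ∣? d
... | no p∤d = inj₁ (coprime-divisor d⊥p d∣p^[1+k])
  where
  d⊥p : Coprime d p
  d⊥p (i∣d , i∣p) with prime⇒irreducible p-prime i∣p
  ... | inj₁ i≡1 = i≡1
  ... | inj₂ refl = ⊥-elim (p∤d i∣d)
... | yes (divides q refl) = multiplyBy-p k q∣p^k
  where
  instance
    p≢0 : NonZero p
    p≢0 = prime⇒nonZero p-prime
  q∣p^k : q ∣ p ^ k
  q∣p^k = *-cancelˡ-∣ p (subst (_∣ p ^ suc k) (*-comm q p) d∣p^[1+k])
  multiplyBy-p : ∀ j → q ∣ p ^ j → q * p ∣ p ^ j ⊎ q * p ≡ p ^ suc j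
  multiplyBy-p zero    q∣1 = inj₂ (begin q * p ≡⟨ cong (_* p) (∣1⇒≡1 q∣1) ⟩ 1 * p ≡⟨ *-comm 1 p ⟩ p * 1 ∎)
  multiplyBy-p (suc j) q∣p^[1+j] with ∣p^[1+k]⇒∣p^k⊎≡p^[1+k] p-prime j q∣p^[1+j]
  ... | inj₁ q∣p^j = inj₁ (subst (q * p ∣_) (*-comm (p ^ j) p) (*-monoˡ-∣ p q∣p^j))
  ... | inj₂ refl  = inj₂ (*-comm (p ^ suc j) p)

module _ {A : Set} (g : A → A) {p} (p-prime : Prime p) (k : ℕ) where

  private
    instance
      p≢0 : NonZero p
      p≢0 = prime⇒nonZero p-prime
    p^k>0 : p ^ k > 0
    p^k>0 = m^n>0 p k
    p^k<p^[1+k] : p ^ k < p ^ suc k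
    p^k<p^[1+k] = ^-monoʳ-< p (nonTrivial⇒n>1 p {{prime⇒nonTrivial p-prime}}) {k} {suc k} ≤-refl

  hasPeriod-p^[1+k]⇔ : ∀ x → HasPeriod g (p ^ suc k) x ⇔ (Periodic g (p ^ suc k) x × ¬ Periodic g (p ^ k) x)
  hasPeriod-p^[1+k]⇔ x = mk⇔ to from
    where
    to : HasPeriod g (p ^ suc k) x → Periodic g (p ^ suc k) x × ¬ Periodic g (p ^ k) x
    to (_ , per , minimal) = per , minimal (p ^ k) p^k>0 p^k<p^[1+k]
    -- gcd s p^(1+k) is a proper divisor of p^(1+k), hence divides p^k.
    from : Periodic g (p ^ suc k) x × ¬ Periodic g (p ^ k) x → HasPeriod g (p ^ suc k) x
    from (per , ¬per) = ≤-trans p^k>0 (<⇒≤ p^k<p^[1+k]) , per , minimal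
      where
      minimal : ∀ s → 1 ≤ s → s < p ^ suc k → ¬ Periodic g s x
      minimal s@(suc _) _ s<p^[1+k] pers with ∣p^[1+k]⇒∣p^k⊎≡p^[1+k] p-prime k (gcd[m,n]∣n s (p ^ suc k))
      ... | inj₁ gcd∣p^k = ¬per (periodic-∣ g gcd∣p^k (periodic-gcd g s (p ^ suc k) pers per))
      ... | inj₂ gcd≡p^[1+k] = <⇒≱ s<p^[1+k] (subst (_≤ s) gcd≡p^[1+k] (∣⇒≤ (gcd[m,n]∣m s (p ^ suc k))))

-- Counting

module _ {A : Set} where

  HasCardinality-⇔ : ∀ {P Q : A → Set} {N} → (∀ x → P x ⇔ Q x) → HasCardinality P N → HasCardinality Q N
  HasCardinality-⇔ P⇔Q (xs , xs! , ∈xs⇔P , |xs|) = xs , xs! , (λ x → ⇔-trans (∈xs⇔P x) (P⇔Q x)) , |xs|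

  HasCardinality-retract : ∀ {B : Set} {P : A → Set} {N} → HasCardinality (λ (_ : B) → ⊤) N →
    (φ : B → A) (ψ : A → B) → (∀ y → ψ (φ y) ≡ y) → (∀ y → P (φ y)) → (∀ {x} → P x → φ (ψ x) ≡ x) →
    HasCardinality P N
  HasCardinality-retract {P = P} (ys , ys! , ∈ys , |ys|) φ ψ ψφ P∘φ φψ =
    map φ ys , Unique.map⁺ φ-injective ys! , (λ x → mk⇔ to from) , trans (length-map φ ys) |ys|
    where
    φ-injective : ∀ {y y′} → φ y ≡ φ y′ → y ≡ y′
    φ-injective {y} {y′} eq = trans (sym (ψφ y)) (trans (cong ψ eq) (ψφ y′))
    to : ∀ {x} → x ∈ map φ ys → P x
    to x∈ with ∈-map⁻ φ x∈
    ... | y , _ , refl = P∘φ y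
    from : ∀ {x} → P x → x ∈ map φ ys
    from Px = subst (_∈ map φ ys) (φψ Px) (∈-map⁺ φ (Equivalence.from (∈ys (ψ _)) tt))

  length-filter+length-filter-∁ : ∀ {Q : A → Set} (Q? : Decidable Q) xs →
    length (filter Q? xs) + length (filter (¬? ∘ Q?) xs) ≡ length xs
  length-filter+length-filter-∁ Q? []       = refl
  length-filter+length-filter-∁ Q? (x ∷ xs) with Q? x
  ... | yes _ = cong suc (length-filter+length-filter-∁ Q? xs)
  ... | no  _ = trans (+-suc _ _) (cong suc (length-filter+length-filter-∁ Q? xs))

  unique-length-≡ : ∀ {xs ys : List A} → Unique xs → Unique ys → (∀ x → x ∈ xs ⇔ x ∈ ys) →
    length xs ≡ length ys
  unique-length-≡ xs! ys! xs≈ys = ↭-length (∼bag⇒↭ (unique∧set⇒bag xs! ys! (λ {x} → xs≈ys x)))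

  HasCardinality-∖ : ∀ {P Q : A → Set} {a b} → Decidable Q → (∀ {x} → Q x → P x) →
    HasCardinality P a → HasCardinality Q b → HasCardinality (λ x → P x × ¬ Q x) (a ∸ b)
  HasCardinality-∖ {P} {Q} Q? Q⊆P (xs , xs! , ∈xs⇔P , refl) (ys , ys! , ∈ys⇔Q , refl) =
    filter ¬Q? xs , Unique.filter⁺ ¬Q? xs! , (λ x → mk⇔ to from) , |P∖Q|
    where
    ¬Q? : Decidable (λ x → ¬ Q x)
    ¬Q? = ¬? ∘ Q?
    to : ∀ {x} → x ∈ filter ¬Q? xs → P x × ¬ Q x
    to x∈ with ∈-filter⁻ ¬Q? {xs = xs} x∈
    ... | x∈xs , ¬Qx = Equivalence.to (∈xs⇔P _) x∈xs , ¬Qx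
    from : ∀ {x} → P x × ¬ Q x → x ∈ filter ¬Q? xs
    from (Px , ¬Qx) = ∈-filter⁺ ¬Q? (Equivalence.from (∈xs⇔P _) Px) ¬Qx
    xs∩Q≈ys : ∀ x → x ∈ filter Q? xs ⇔ x ∈ ys
    xs∩Q≈ys x = mk⇔ (λ x∈ → Equivalence.from (∈ys⇔Q x) (proj₂ (∈-filter⁻ Q? {xs = xs} x∈)))
      (λ x∈ys → let Qx = Equivalence.to (∈ys⇔Q x) x∈ys in
        ∈-filter⁺ Q? (Equivalence.from (∈xs⇔P x) (Q⊆P Qx)) Qx)
    |P∖Q| : length (filter ¬Q? xs) ≡ length xs ∸ length ys
    |P∖Q| = begin
      length (filter ¬Q? xs)
        ≡⟨ m+n∸m≡n (length (filter Q? xs)) _ ⟨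
      length (filter Q? xs) + length (filter ¬Q? xs) ∸ length (filter Q? xs)
        ≡⟨ cong₂ _∸_ (length-filter+length-filter-∁ Q? xs)
                     (unique-length-≡ (Unique.filter⁺ Q? xs!) ys! xs∩Q≈ys) ⟩
      length xs ∸ length ys ∎

allVecs : ∀ m → List (Vec Bool m)
allVecs zero    = [] ∷ []
allVecs (suc m) = map (true ∷_) (allVecs m) ++ map (false ∷_) (allVecs m)

length-allVecs : ∀ m → length (allVecs m) ≡ 2 ^ m
length-allVecs zero    = refl
length-allVecs (suc m) = begin
  length (map (true ∷_) (allVecs m) ++ map (false ∷_) (allVecs m))
    ≡⟨ length-++ (map (true ∷_) (allVecs m)) ⟩
  length (map (true ∷_) (allVecs m)) + length (map (false ∷_) (allVecs m))
    ≡⟨ cong₂ _+_ (length-map _ (allVecs m)) (length-map _ (allVecs m)) ⟩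
  length (allVecs m) + length (allVecs m)
    ≡⟨ cong (λ l → l + l) (length-allVecs m) ⟩
  2 ^ m + 2 ^ m
    ≡⟨ cong (2 ^ m +_) (+-identityʳ (2 ^ m)) ⟨
  2 ^ suc m ∎

∈-allVecs : ∀ {m} (v : Vec Bool m) → v ∈ allVecs m
∈-allVecs []          = here refl
∈-allVecs (true ∷ v)  = ∈-++⁺ˡ (∈-map⁺ (true ∷_) (∈-allVecs v))
∈-allVecs (false ∷ v) = ∈-++⁺ʳ (map (true ∷_) (allVecs _)) (∈-map⁺ (false ∷_) (∈-allVecs v))

allVecs-unique : ∀ m → Unique (allVecs m)
allVecs-unique zero    = All.[] ∷ []
allVecs-unique (suc m) =
  Unique.++⁺ (Unique.map⁺ ∷-injectiveʳ (allVecs-unique m)) (Unique.map⁺ ∷-injectiveʳ (allVecs-unique m)) disjoint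
  where
  disjoint : ∀ {v} → ¬ (v ∈ map (true ∷_) (allVecs m) × v ∈ map (false ∷_) (allVecs m))
  disjoint (v∈₁ , v∈₂) with ∈-map⁻ (true ∷_) v∈₁ | ∈-map⁻ (false ∷_) v∈₂
  ... | _ , _ , refl | _ , _ , ()

vecBool-cardinality : ∀ m → HasCardinality (λ (_ : Vec Bool m) → ⊤) (2 ^ m)
vecBool-cardinality m = allVecs m , allVecs-unique m , (λ v → mk⇔ _ (λ _ → ∈-allVecs v)) , length-allVecs m

-- Closed walks and simple cycles

ClosedWalk : ∀ {n} → CBN n → ℕ → (ℕ → Fin n) → Set
ClosedWalk f L w = (∀ i → i < L → Edge f (w i) (w (suc i))) × w L ≡ w 0

Repeats : ∀ {n} → ℕ → (ℕ → Fin n) → Set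
Repeats L w = ∃ λ j → j < L × ∃ λ i → i < j × w i ≡ w j

repeats? : ∀ {n} L (w : ℕ → Fin n) → Dec (Repeats L w)
repeats? L w = anyUpTo? (λ j → anyUpTo? (λ i → w i ≟ᶠ w j) j) L

¬repeats⇒injective : ∀ {n L} {w : ℕ → Fin n} → ¬ Repeats L w → ∀ i j → i < L → j < L → w i ≡ w j → i ≡ j
¬repeats⇒injective ¬rep i j i<L j<L wi≡wj with <-cmp i j
... | tri< i<j _ _ = ⊥-elim (¬rep (j , j<L , i , i<j , wi≡wj))
... | tri≈ _ i≡j _ = i≡j
... | tri> _ _ j<i = ⊥-elim (¬rep (i , i<L , j , j<i , sym wi≡wj))

module _ {n} (f : CBN n) where

  -- A closed walk returning to w i at time d + i splits into the loop w i … w (d + i)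
  -- and the closed walk that skips it.
  module Shortcut {i d m} {w : ℕ → Fin n} (cw : ClosedWalk f (i + m + d) w) (rep : w (d + i) ≡ w i) where

    loop : ℕ → Fin n
    loop k = w (k + i)

    loop-closed : ClosedWalk f d loop
    loop-closed = (λ k k<d → proj₁ cw (k + i) (k+i<L k<d)) , rep
      where
      k+i<L : ∀ {k} → k < d → k + i < i + m + d
      k+i<L {k} k<d = <-≤-trans (+-monoˡ-< i k<d)
        (subst (d + i ≤_) (+-comm d (i + m)) (+-monoʳ-≤ d (m≤m+n i m)))

    shortcut : ℕ → Fin n
    shortcut k with k ≤? i
    ... | yes _ = w k
    ... | no  _ = w (k + d)

    shortcut-≤ : ∀ {k} → k ≤ i → shortcut k ≡ w k
    shortcut-≤ {k} k≤i with k ≤? i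
    ... | yes _   = refl
    ... | no  k≰i = ⊥-elim (k≰i k≤i)

    shortcut-≥ : ∀ {k} → i ≤ k → shortcut k ≡ w (k + d)
    shortcut-≥ {k} i≤k with k ≤? i
    ... | yes k≤i rewrite ≤-antisym k≤i i≤k = trans (sym rep) (cong w (+-comm d i))
    ... | no  _   = refl

    shortcut-closed : ClosedWalk f (i + m) shortcut
    shortcut-closed = edge , closes
      where
      edge : ∀ k → k < i + m → Edge f (shortcut k) (shortcut (suc k))
      edge k k<i+m = by-cases (k <? i)
        where
        by-cases : Dec (k < i) → Edge f (shortcut k) (shortcut (suc k))
        by-cases (yes k<i) = subst₂ (Edge f) (sym (shortcut-≤ (<⇒≤ k<i))) (sym (shortcut-≤ k<i))
          (proj₁ cw k (<-≤-trans k<i (≤-trans (m≤m+n i m) (m≤m+n (i + m) d))))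
        by-cases (no k≮i) = subst₂ (Edge f) (sym (shortcut-≥ (≮⇒≥ k≮i))) (sym (shortcut-≥ (m≤n⇒m≤1+n (≮⇒≥ k≮i))))
          (proj₁ cw (k + d) (+-monoˡ-< d k<i+m))
      closes : shortcut (i + m) ≡ shortcut 0
      closes = trans (shortcut-≥ (m≤m+n i m)) (trans (proj₂ cw) (sym (shortcut-≤ z≤n)))

  cycles∣⇒closedWalk∣ : ∀ {c} → (∀ L → SimpleCycle f L → c ∣ L) → ∀ L w → ClosedWalk f L w → c ∣ L
  cycles∣⇒closedWalk∣ {c} c∣cycles = <-rec _ go
    where
    go : ∀ L → (∀ {L′} → L′ < L → ∀ w → ClosedWalk f L′ w → c ∣ L′) → ∀ w → ClosedWalk f L w → c ∣ L
    go L rec w cw with repeats? L w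
    go zero    rec w cw | no ¬rep = c ∣0
    go (suc L) rec w cw | no ¬rep =
      c∣cycles (suc L) (s≤s z≤n , w , proj₁ cw , proj₂ cw , ¬repeats⇒injective ¬rep)
    go L rec w cw | yes (j , j<L , i , i<j , wi≡wj) =
      subst (c ∣_) L≡ (∣m∣n⇒∣m+n (rec i+m<L S.shortcut S.shortcut-closed) (rec d<L S.loop S.loop-closed))
      where
      d m : ℕ
      d = j ∸ i
      m = L ∸ j
      d+i≡j : d + i ≡ j
      d+i≡j = m∸n+n≡m (<⇒≤ i<j)
      L≡ : i + m + d ≡ L
      L≡ = begin
        i + m + d   ≡⟨ rearrange i m d ⟩
        m + (d + i) ≡⟨ cong (m +_) d+i≡j ⟩
        m + j       ≡⟨ m∸n+n≡m (<⇒≤ j<L) ⟩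
        L           ∎
        where
        rearrange : ∀ i m d → i + m + d ≡ m + (d + i)
        rearrange = solve-∀
      module S = Shortcut (subst (λ L → ClosedWalk f L w) (sym L≡) cw) (trans (cong w d+i≡j) (sym wi≡wj))
      d<L : d < L
      d<L = ≤-<-trans (m∸n≤m j i) j<L
      i+m<L : i + m < L
      i+m<L = subst (i + m <_) L≡ (m<m+n (i + m) (m<n⇒0<n∸m i<j))

walkLength : ∀ {A : Set} {R : A → A → Set} {a b} → Star R a b → ℕ
walkLength ε       = 0
walkLength (_ ◅ w) = suc (walkLength w)

walkLength-◅◅ : ∀ {A : Set} {R : A → A → Set} {a b c} (w : Star R a b) (w′ : Star R b c) →
  walkLength (w ◅◅ w′) ≡ walkLength w + walkLength w′
walkLength-◅◅ ε       w′ = refl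
walkLength-◅◅ (_ ◅ w) w′ = cong suc (walkLength-◅◅ w w′)

DividesClosedWalks : ℕ → ∀ {n} → CBN n → Set
DividesClosedWalks t f = ∀ {u} (w : Star (Edge f) u u) → t ∣ walkLength w

module _ {n} (f : CBN n) where

  vertices : ∀ {u v} → Star (Edge f) u v → ℕ → Fin n
  vertices {u} ε       _       = u
  vertices {u} (_ ◅ w) zero    = u
  vertices {u} (_ ◅ w) (suc k) = vertices w k

  vertices-start : ∀ {u v} (w : Star (Edge f) u v) → vertices w 0 ≡ u
  vertices-start ε       = refl
  vertices-start (_ ◅ w) = refl

  vertices-end : ∀ {u v} (w : Star (Edge f) u v) → vertices w (walkLength w) ≡ v
  vertices-end ε       = refl
  vertices-end (_ ◅ w) = vertices-end w

  vertices-edge : ∀ {u v} (w : Star (Edge f) u v) k → k < walkLength w →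
    Edge f (vertices w k) (vertices w (suc k))
  vertices-edge (e ◅ w) zero    _         = subst (Edge f _) (sym (vertices-start w)) e
  vertices-edge (_ ◅ w) (suc k) (s≤s k<l) = vertices-edge w k k<l

  loopNumber-dividesClosedWalks : ∀ {c} → IsLoopNumber f c → DividesClosedWalks c f
  loopNumber-dividesClosedWalks (c∣cycles , _) w = cycles∣⇒closedWalk∣ f c∣cycles (walkLength w) (vertices w)
    (vertices-edge w , trans (vertices-end w) (sym (vertices-start w)))

-- Conjunctive networks

⋀-true⁻ : ∀ {m} (g : Fin m → Bool) → ⋀ g ≡ true → ∀ i → g i ≡ true
⋀-true⁻ g ⋀g≡true fzero    with g fzero
... | true  = refl
... | false = ⋀g≡true
⋀-true⁻ g ⋀g≡true (fsuc i) with g fzero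
⋀-true⁻ g ⋀g≡true (fsuc i) | true = ⋀-true⁻ (g ∘ fsuc) ⋀g≡true i
⋀-true⁻ g ()      (fsuc i) | false

⋀-true⁺ : ∀ {m} (g : Fin m → Bool) → (∀ i → g i ≡ true) → ⋀ g ≡ true
⋀-true⁺ {zero}  g _   = refl
⋀-true⁺ {suc m} g all rewrite all fzero = ⋀-true⁺ (g ∘ fsuc) (all ∘ fsuc)

⋀-false⁺ : ∀ {m} (g : Fin m → Bool) i → g i ≡ false → ⋀ g ≡ false
⋀-false⁺ g fzero    gi≡false rewrite gi≡false = refl
⋀-false⁺ g (fsuc i) gi≡false with g fzero
... | true  = ⋀-false⁺ (g ∘ fsuc) i gi≡false
... | false = refl

module _ {n} (f : CBN n) where

  apply-true⇒input-true : ∀ {x u v} → lookup (apply f x) v ≡ true → Edge f u v → lookup x u ≡ true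
  apply-true⇒input-true {x} {u} {v} fv≡true u→v =
    subst (λ b → not b ∨ lookup x u ≡ true) u→v
      (⋀-true⁻ _ (trans (sym (lookup∘tabulate _ v)) fv≡true) u)

  apply-constantInputs : NonemptyInputs f → ∀ {x v b} → (∀ {u} → Edge f u v → lookup x u ≡ b) →
    lookup (apply f x) v ≡ b
  apply-constantInputs nonempty {x} {v} {b} inputs≡b = trans (lookup∘tabulate _ v) (by-value b inputs≡b)
    where
    by-value : ∀ b → (∀ {u} → Edge f u v → lookup x u ≡ b) → ⋀ (λ u → not (f v u) ∨ lookup x u) ≡ b
    by-value true  inputs≡true = ⋀-true⁺ _ λ u → input-true u (f v u) refl
      where
      input-true : ∀ u b → f v u ≡ b → not b ∨ lookup x u ≡ true
      input-true u false _   = refl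
      input-true u true  u→v = inputs≡true u→v
    by-value false inputs≡false with nonempty v
    ... | u , u→v = ⋀-false⁺ _ u (subst (λ b → not b ∨ lookup x u ≡ false) (sym u→v) (inputs≡false u→v))

≡-by-true : ∀ {a b : Bool} → (a ≡ true → b ≡ true) → (b ≡ true → a ≡ true) → a ≡ b
≡-by-true {false} {false} _ _ = refl
≡-by-true {false} {true}  _ b⇒a = b⇒a refl
≡-by-true {true}  {false} a⇒b _ = sym (a⇒b refl)
≡-by-true {true}  {true}  _ _ = refl

≡-tabulate : ∀ {A : Set} {m} {xs : Vec A m} {g : Fin m → A} → (∀ i → lookup xs i ≡ g i) → xs ≡ tabulate g
≡-tabulate {xs = xs} xs≗g = trans (sym (tabulate∘lookup xs)) (tabulate-cong xs≗g)

module PeriodicPoints {n} (f : CBN n) (nonempty : NonemptyInputs f) (strong : StronglyConnected f)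
                      (root : Fin n) (t-1 : ℕ) (t∣walks : DividesClosedWalks (suc t-1) f) where

  t : ℕ
  t = suc t-1

  F : Vec Bool n → Vec Bool n
  F = apply f

  infix 4 _≡ₜ_
  _≡ₜ_ : ℕ → ℕ → Set
  a ≡ₜ b = a % t ≡ b % t

  ≡ₜ-byComplement : ∀ {a b c} → t ∣ a + c → t ∣ b + c → a ≡ₜ b
  ≡ₜ-byComplement {a} {b} {c} t∣a+c t∣b+c = begin
    a % t           ≡⟨ %-remove-+ʳ a (subst (t ∣_) (+-comm b c) t∣b+c) ⟨
    (a + (c + b)) % t ≡⟨ cong (_% t) (+-assoc a c b) ⟨
    (a + c + b) % t ≡⟨ %-remove-+ˡ b t∣a+c ⟩
    b % t           ∎

  +-congˡₜ : ∀ c {a b} → a ≡ₜ b → c + a ≡ₜ c + b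
  +-congˡₜ c {a} {b} a≡b = begin
    (c + a) % t             ≡⟨ %-distribˡ-+ c a t ⟩
    (c % t + a % t) % t     ≡⟨ cong (λ r → (c % t + r) % t) a≡b ⟩
    (c % t + b % t) % t     ≡⟨ %-distribˡ-+ c b t ⟨
    (c + b) % t             ∎

  *-congʳₜ : ∀ c {a b} → a ≡ₜ b → a * c ≡ₜ b * c
  *-congʳₜ c {a} {b} a≡b = begin
    (a * c) % t             ≡⟨ %-distribˡ-* a c t ⟩
    (a % t * (c % t)) % t   ≡⟨ cong (λ r → (r * (c % t)) % t) a≡b ⟩
    (b % t * (c % t)) % t   ≡⟨ %-distribˡ-* b c t ⟨
    (b * c) % t             ∎

  mod-cong : ∀ a b → a ≡ₜ b → a mod t ≡ b mod t
  mod-cong a b a≡b = fromℕ<-cong _ _ a≡b (m%n<n a t) (m%n<n b t)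

  toℕ-mod : ∀ (a : Fin t) → toℕ a mod t ≡ a
  toℕ-mod a = trans (fromℕ<-cong _ _ (m<n⇒m%n≡m (toℕ<n a)) _ (toℕ<n a)) (fromℕ<-toℕ a (toℕ<n a))

  level : Fin n → ℕ
  level v = walkLength (strong root v)

  walk-level : ∀ {v} (w : Star (Edge f) root v) → walkLength w ≡ₜ level v
  walk-level {v} w = ≡ₜ-byComplement {walkLength w} {level v} (t∣w+back w) (t∣w+back (strong root v))
    where
    t∣w+back : (w : Star (Edge f) root v) → t ∣ walkLength w + walkLength (strong v root)
    t∣w+back w = subst (t ∣_) (walkLength-◅◅ w (strong v root)) (t∣walks (w ◅◅ strong v root))

  edge-level : ∀ {u v} → Edge f u v → suc (level u) ≡ₜ level v
  edge-level {u} {v} u→v = subst (_≡ₜ level v) (trans (walkLength-◅◅ (strong root u) (u→v ◅ ε)) (+-comm (level u) 1))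
    (walk-level (strong root u ◅◅ (u→v ◅ ε)))

  t∣level-root : t ∣ level root
  t∣level-root = m%n≡0⇒n∣m (level root) t (sym (walk-level ε))

  -- Vertex v at time s carries y at index s - level v (mod t); since level v * (t - 1) ≡ - level v
  -- (mod t), the index is written without truncated subtraction.
  embed : ℕ → Vec Bool t → Vec Bool n
  embed s y = tabulate λ v → lookup y ((s + level v * t-1) mod t)

  edge-phase : ∀ s {u v} → Edge f u v → s + level u * t-1 ≡ₜ suc s + level v * t-1
  edge-phase s {u} {v} u→v = begin
    (s + level u * t-1) % t           ≡⟨ %-remove-+ʳ (s + level u * t-1) (∣-refl {t}) ⟨
    (s + level u * t-1 + t) % t       ≡⟨ cong (_% t) (rearrange s (level u) t-1) ⟩
    (suc s + suc (level u) * t-1) % t ≡⟨ +-congˡₜ (suc s) (*-congʳₜ t-1 {suc (level u)} {level v} (edge-level u→v)) ⟩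
    (suc s + level v * t-1) % t       ∎
    where
    rearrange : ∀ s l t-1 → s + l * t-1 + suc t-1 ≡ suc s + suc l * t-1
    rearrange = solve-∀

  apply-embed : ∀ s y → F (embed s y) ≡ embed (suc s) y
  apply-embed s y = ≡-tabulate λ v → apply-constantInputs f nonempty {x = embed s y} λ {u} u→v →
    trans (lookup∘tabulate (λ u → lookup y ((s + level u * t-1) mod t)) u)
      (cong (lookup y) (mod-cong (s + level u * t-1) (suc s + level v * t-1) (edge-phase s u→v)))

  iter-embed : ∀ s y → iter F s (embed 0 y) ≡ embed s y
  iter-embed zero    y = refl
  iter-embed (suc s) y = trans (cong F (iter-embed s y)) (apply-embed s y)

  embed-periodic : ∀ y → Periodic F t (embed 0 y)
  embed-periodic y = trans (iter-embed t y)
    (tabulate-cong λ v → cong (lookup y) (mod-cong (t + level v * t-1) (level v * t-1) (%-remove-+ˡ (level v * t-1) (∣-refl {t}))))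

  restrict : Vec Bool n → Vec Bool t
  restrict x = tabulate λ a → lookup (iter F (toℕ a) x) root

  restrict-embed : ∀ y → restrict (embed 0 y) ≡ y
  restrict-embed y = trans (tabulate-cong at) (tabulate∘lookup y)
    where
    at : ∀ a → lookup (iter F (toℕ a) (embed 0 y)) root ≡ lookup y a
    at a = begin
      lookup (iter F (toℕ a) (embed 0 y)) root     ≡⟨ cong (λ x → lookup x root) (iter-embed (toℕ a) y) ⟩
      lookup (embed (toℕ a) y) root               ≡⟨ lookup∘tabulate _ root ⟩
      lookup y ((toℕ a + level root * t-1) mod t) ≡⟨ cong (lookup y) (mod-cong (toℕ a + level root * t-1) (toℕ a) root-phase) ⟩
      lookup y (toℕ a mod t)                      ≡⟨ cong (lookup y) (toℕ-mod a) ⟩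
      lookup y a                                  ∎
      where
      root-phase : toℕ a + level root * t-1 ≡ₜ toℕ a
      root-phase = %-remove-+ʳ (toℕ a) (∣m⇒∣m*n t-1 t∣level-root)

  module Trajectory {x} (x-periodic : Periodic F t x) where

    state : ℕ → Fin n → Bool
    state s v = lookup (iter F s x) v

    state-+-* : ∀ s q v → state (s + q * t) v ≡ state s v
    state-+-* s q v = cong (λ z → lookup z v)
      (trans (iter-+ F s (q * t) x) (cong (iter F s) (periodic-* F t x-periodic q)))

    state-closedWalk : ∀ {u} (w : Star (Edge f) u u) s → state (s + walkLength w) u ≡ state s u
    state-closedWalk {u} w s with t∣walks w
    ... | divides q eq rewrite eq = state-+-* s q u

    state-true-backward : ∀ {u v} (w : Star (Edge f) u v) s → state (s + walkLength w) v ≡ true → state s u ≡ true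
    state-true-backward {u} ε s v-true = subst (λ r → state r u ≡ true) (+-identityʳ s) v-true
    state-true-backward {v = v} (u→j ◅ w) s v-true = apply-true⇒input-true f {x = iter F s x}
      (state-true-backward w (suc s) (subst (λ r → state r v ≡ true) (+-suc s (walkLength w)) v-true)) u→j

    -- Truth flows backwards along edges; going once around the closed walk u → v ⇝ u, whose length
    -- is a multiple of t, turns this into forward flow along u → v.
    edge-state : ∀ {u v} → Edge f u v → ∀ s → state (suc s) v ≡ state s u
    edge-state {u} {v} u→v s = ≡-by-true (λ v-true → apply-true⇒input-true f {x = iter F s x} v-true u→v) forward
      where
      forward : state s u ≡ true → state (suc s) v ≡ true
      forward u-true = state-true-backward (strong v u) (suc s)
        (trans (cong (λ r → state r u) (sym (+-suc s _))) (trans (state-closedWalk (u→v ◅ strong v u) s) u-true))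

    walk-state : ∀ {u v} (w : Star (Edge f) u v) s → state (s + walkLength w) v ≡ state s u
    walk-state {u} ε        s = cong (λ r → state r u) (+-identityʳ s)
    walk-state {v = v} (u→j ◅ w) s = begin
      state (s + suc (walkLength w)) v ≡⟨ cong (λ r → state r v) (+-suc s (walkLength w)) ⟩
      state (suc s + walkLength w) v   ≡⟨ walk-state w (suc s) ⟩
      state (suc s) _                  ≡⟨ edge-state u→j s ⟩
      state s _                        ∎

    embed-restrict : embed 0 (restrict x) ≡ x
    embed-restrict = trans (tabulate-cong at) (tabulate∘lookup x)
      where
      at : ∀ v → lookup (restrict x) ((level v * t-1) mod t) ≡ lookup x v
      at v = begin
        lookup (restrict x) (m mod t)  ≡⟨ lookup∘tabulate (λ a → state (toℕ a) root) (m mod t) ⟩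
        state (toℕ (m mod t)) root     ≡⟨ cong (λ r → state r root) (toℕ-fromℕ< (m%n<n m t)) ⟩
        state (m % t) root             ≡⟨ state-+-* (m % t) (m / t) root ⟨
        state (m % t + m / t * t) root ≡⟨ cong (λ r → state r root) (m≡m%n+[m/n]*n m t) ⟨
        state m root                   ≡⟨ walk-state (strong root v) m ⟨
        state (m + level v) v          ≡⟨ cong (λ r → state r v) (rearrange (level v) t-1) ⟩
        state (0 + level v * t) v      ≡⟨ state-+-* 0 (level v) v ⟩
        state 0 v                      ∎
        where
        m : ℕ
        m = level v * t-1
        rearrange : ∀ l t-1 → l * t-1 + l ≡ 0 + l * suc t-1
        rearrange = solve-∀

  cardinality : HasCardinality (Periodic F t) (2 ^ t)
  cardinality = HasCardinality-retract (vecBool-cardinality t) (embed 0) restrict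
    restrict-embed embed-periodic Trajectory.embed-restrict

periodicPoints-cardinality : ∀ {n} (f : CBN n) → NonemptyInputs f → StronglyConnected f → Fin n →
  ∀ t .{{_ : NonZero t}} → DividesClosedWalks t f → HasCardinality (Periodic (apply f) t) (2 ^ t)
periodicPoints-cardinality f nonempty strong root (suc t-1) = PeriodicPoints.cardinality f nonempty strong root t-1

mainTheorem7 : (n : ℕ) → 1 ≤ n → (f : CBN n) → NonemptyInputs f →
    StronglyConnected f → (c : ℕ) → IsLoopNumber f c →
    (p k : ℕ) → Prime p → 1 ≤ k → p ^ k ∣ c →
    HasCardinality (HasPeriod (apply f) (p ^ k)) (2 ^ (p ^ k) ∸ 2 ^ (p ^ (k ∸ 1)))
mainTheorem7 (suc _) _ f nonempty strong c loopNumber p (suc k) p-prime _ p^[1+k]∣c =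
  HasCardinality-⇔ (λ x → ⇔-sym (hasPeriod-p^[1+k]⇔ (apply f) p-prime k x))
    (HasCardinality-∖ (periodic? (p ^ k)) (periodic-∣ (apply f) (n∣m*n p))
      (cardinality (suc k) p^[1+k]∣c)
      (cardinality k (∣-trans (n∣m*n p) p^[1+k]∣c)))
  where
  instance
    p≢0 : NonZero p
    p≢0 = prime⇒nonZero p-prime
  periodic? : ∀ m → Decidable (Periodic (apply f) m)
  periodic? m x = ≡-dec _≟ᵇ_ (iter (apply f) m x) x
  cardinality : ∀ m → p ^ m ∣ c → HasCardinality (Periodic (apply f) (p ^ m)) (2 ^ (p ^ m))
  cardinality m p^m∣c = periodicPoints-cardinality f nonempty strong fzero (p ^ m) {{m^n≢0 p m}}
    (λ w → ∣-trans p^m∣c (loopNumber-dividesClosedWalks f loopNumber w))
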